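{- Let $n,m\ge2$, let $q=(q_0,\ldots,q_{n-1})$ and $q'=(q'_0,\ldots,q'_{m-1})$ be quiddities of orders $n$ and $m$ (extended periodically, $q_{j+n}=q_j$, $q'_{i+m}=q'_i$), and let $M=\begin{pmatrix}a&b\\ c&d\end{pmatrix}$ have positive integer entries with $ad-bc=1$, $q_0<\frac ba$ and $q'_0<\frac ca$. Let $(a_{i,j})_{(i,j)\in\mathbb{Z}^2}$ be the array defined by $a_{i,j+1}=q_ja_{i,j}-a_{i,j-1}$ and $a_{i+1,j}=q'_ia_{i,j}-a_{i-1,j}$ for all $i,j$, with $a_{0,0}=a$, $a_{0,1}=b$, $a_{1,0}=c$, $a_{1,1}=d$. Then $a_{i,j}$ is a positive integer for all $0\le i\le m-1$, $0\le j\le n-1$.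
   Context: A quiddity of order $n\ge3$ is a sequence $(q_0,\ldots,q_{n-1})$ of positive integers such that some triangulation of a convex $n$-gon with vertices labelled $0,\ldots,n-1$ cyclically has exactly $q_i$ triangles incident to vertex $i$ for each $i$; the (degenerate) quiddity of order $2$ is $(0,0)$. -}

module Defs where

open import Data.Nat as ℕ using (ℕ; zero; suc; _∸_)
open import Data.Fin using (Fin; toℕ)
open import Data.Integer using (ℤ; +_)
open import Data.List using (List; []; _∷_; _++_; length; filter)
open import Data.Product using (Σ; _×_; _,_; ∃)
open import Data.Sum using (_⊎_)
open import Relation.Binary.PropositionalEquality using (_≡_)
open import Relation.Nullary using (Dec; yes; no)
open import Relation.Nullary.Decidable using (_⊎-dec_)

-- A triangulation of the convex polygon with vertices i, i+1, ..., k
-- (in this cyclic order).  If k = i+1 the "polygon" is a single edge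
-- and the triangulation is empty.  Otherwise the edge {i,k} lies in a
-- unique triangle {i,j,k} with i < j < k, and the triangulation is
-- that triangle together with triangulations of the sub-polygons
-- i..j and j..k.
data Triangulation (i k : ℕ) : Set where
  edge : k ≡ suc i → Triangulation i k
  node : (j : ℕ) → i ℕ.< j → j ℕ.< k →
         Triangulation i j → Triangulation j k → Triangulation i k

Triangle : Set
Triangle = ℕ × ℕ × ℕ

triangles : ∀ {i k} → Triangulation i k → List Triangle
triangles (edge _) = []
triangles {i} {k} (node j _ _ l r) = (i , j , k) ∷ (triangles l ++ triangles r)

incident? : (v : ℕ) → (t : Triangle) → Dec (v ≡ Data.Product.proj₁ t ⊎ (v ≡ Data.Product.proj₁ (Data.Product.proj₂ t) ⊎ v ≡ Data.Product.proj₂ (Data.Product.proj₂ t)))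
incident? v (x , y , z) = (v ℕ.≟ x) ⊎-dec ((v ℕ.≟ y) ⊎-dec (v ℕ.≟ z))

degree : ∀ {i k} → Triangulation i k → ℕ → ℕ
degree t v = length (filter (incident? v) (triangles t))

-- Order 2: the degenerate quiddity (0,0).
-- Order n ≥ 3: q consists of positive integers and some triangulation of
-- the convex n-gon with vertices 0,...,n-1 has exactly q i triangles
-- incident to vertex i.
IsQuiddity : (n : ℕ) → (Fin n → ℕ) → Set
IsQuiddity n q =
  (n ≡ 2 × (∀ i → q i ≡ 0))
  ⊎ (3 ℕ.≤ n × (∀ i → 0 ℕ.< q i) ×
     Σ (Triangulation 0 (n ∸ 1)) (λ t → ∀ i → q i ≡ degree t (toℕ i)))

IsPeriodicQuiddity : (n : ℕ) → (ℤ → ℤ) → Set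
IsPeriodicQuiddity n q =
  (∀ j → q (j Data.Integer.+ + n) ≡ q j) ×
  Σ (Fin n → ℕ) (λ q₀ → IsQuiddity n q₀ × (∀ i → q (+ toℕ i) ≡ + q₀ i))

module Submission where

-- The heart of the proof is a fact about one triangulated polygon with
-- vertices i, i+1, ..., k.  Let x solve  x(v+1) = deg(v)·x(v) - x(v-1)  at
-- every interior vertex v, where deg(v) counts the triangles at v.  Then, by
-- induction on the triangulation, x(i+1) = deg(i)·x(i) + x(k) and
-- x(k-1) = x(i) + deg(k)·x(k); consequently the apex j of the triangle on the
-- edge {i,k} satisfies x(j) = x(i) + x(k), so x > 0 on i..k whenever
-- x(i), x(k) > 0.
--
-- A quiddity of order n is the degree sequence of a triangulation of 0..n-1.
-- If x(j+1) = q(j)·x(j) - x(j-1) on ℤ and x(-1) < 0 < x(0), the first end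
-- relation gives x(n-1) = -x(-1) > 0, hence x > 0 on 0..n-1 (positive-row).
--
-- The theorem applies positive-row to row 0 of the array (A(0,-1) = q(0)a - b),
-- to the negated row -1 (A(-1,-1) > 0 since a·A(-1,-1) = (b-q(0)a)(c-q'(0)a)+1)
-- and then to every column j, which starts with A(-1,j) < 0 < A(0,j).

open import Defs
open import Data.Nat as ℕ using (ℕ; zero; suc; pred; _≤_; z≤n; s≤s; s≤s⁻¹)
import Data.Nat.Properties as ℕP
open import Data.Fin using (Fin; toℕ; fromℕ<)
open import Data.Fin.Properties using (toℕ-fromℕ<; toℕ<n)
open import Data.Integer using (ℤ; +_; _+_; _-_; _*_; -_; _<_; +<+; -1ℤ; 0ℤ; 1ℤ)
import Data.Integer.Properties as ℤP
open import Data.Integer.Solver using (module +-*-Solver)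
open import Data.List using (filter; length; _++_)
open import Data.List.Properties using (length-++; filter-++; filter-accept; filter-reject)
open import Data.Product using (Σ; _×_; _,_; proj₁; proj₂)
open import Data.Sum as Sum using (_⊎_; inj₁; inj₂)
open import Relation.Nullary using (¬_)
open import Relation.Binary.PropositionalEquality
open +-*-Solver

Apex : ℕ → ℕ → ℕ → ℕ → Set
Apex v i j k = v ≡ i ⊎ (v ≡ j ⊎ v ≡ k)

not-apex : ∀ {v i j k} → v ≢ i → v ≢ j → v ≢ k → ¬ Apex v i j k
not-apex v≢i _ _ (inj₁ v≡i) = v≢i v≡i
not-apex _ v≢j _ (inj₂ (inj₁ v≡j)) = v≢j v≡j
not-apex _ _ v≢k (inj₂ (inj₂ v≡k)) = v≢k v≡k

degree-++ : ∀ {i j k} (l : Triangulation i j) (r : Triangulation j k) v →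
  length (filter (incident? v) (triangles l ++ triangles r)) ≡ degree l v ℕ.+ degree r v
degree-++ l r v =
  trans (cong length (filter-++ (incident? v) (triangles l) (triangles r)))
        (length-++ (filter (incident? v) (triangles l)))

degree-node-apex : ∀ {i j k} (p : i ℕ.< j) (p′ : j ℕ.< k)
  (l : Triangulation i j) (r : Triangulation j k) {v} →
  Apex v i j k → degree (node j p p′ l r) v ≡ suc (degree l v ℕ.+ degree r v)
degree-node-apex p p′ l r {v} apex =
  trans (cong length (filter-accept (incident? v) apex)) (cong suc (degree-++ l r v))

degree-node-other : ∀ {i j k} (p : i ℕ.< j) (p′ : j ℕ.< k)
  (l : Triangulation i j) (r : Triangulation j k) {v} →
  ¬ Apex v i j k → degree (node j p p′ l r) v ≡ degree l v ℕ.+ degree r v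
degree-node-other p p′ l r {v} not-at-apex =
  trans (cong length (filter-reject (incident? v) not-at-apex)) (degree-++ l r v)

degree-below : ∀ {i k} (t : Triangulation i k) {v} → v ℕ.< i → degree t v ≡ 0
degree-below (edge _) _ = refl
degree-below (node j p p′ l r) v<i =
  trans (degree-node-other p p′ l r (not-apex (ℕP.<⇒≢ v<i) (ℕP.<⇒≢ v<j) (ℕP.<⇒≢ (ℕP.<-trans v<j p′))))
        (cong₂ ℕ._+_ (degree-below l v<i) (degree-below r v<j))
  where v<j = ℕP.<-trans v<i p

degree-above : ∀ {i k} (t : Triangulation i k) {v} → k ℕ.< v → degree t v ≡ 0
degree-above (edge _) _ = refl
degree-above (node j p p′ l r) k<v =
  trans (degree-node-other p p′ l r (not-apex (ℕP.>⇒≢ (ℕP.<-trans p j<v)) (ℕP.>⇒≢ j<v) (ℕP.>⇒≢ k<v)))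
        (cong₂ ℕ._+_ (degree-above l j<v) (degree-above r k<v))
  where j<v = ℕP.<-trans p′ k<v

degree-node-left : ∀ {i j k} (p : i ℕ.< j) (p′ : j ℕ.< k)
  (l : Triangulation i j) (r : Triangulation j k) {u} →
  i ℕ.< u → u ℕ.< j → degree (node j p p′ l r) u ≡ degree l u
degree-node-left p p′ l r {u} i<u u<j =
  trans (degree-node-other p p′ l r (not-apex (ℕP.>⇒≢ i<u) (ℕP.<⇒≢ u<j) (ℕP.<⇒≢ (ℕP.<-trans u<j p′))))
        (trans (cong (degree l u ℕ.+_) (degree-below r u<j)) (ℕP.+-identityʳ _))

degree-node-right : ∀ {i j k} (p : i ℕ.< j) (p′ : j ℕ.< k)
  (l : Triangulation i j) (r : Triangulation j k) {u} →
  j ℕ.< u → u ℕ.< k → degree (node j p p′ l r) u ≡ degree r u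
degree-node-right p p′ l r {u} j<u u<k =
  trans (degree-node-other p p′ l r (not-apex (ℕP.>⇒≢ (ℕP.<-trans p j<u)) (ℕP.>⇒≢ j<u) (ℕP.<⇒≢ u<k)))
        (cong (ℕ._+ degree r u) (degree-above l j<u))

degree-node-first : ∀ {i j k} (p : i ℕ.< j) (p′ : j ℕ.< k)
  (l : Triangulation i j) (r : Triangulation j k) →
  degree (node j p p′ l r) i ≡ suc (degree l i)
degree-node-first {i} p p′ l r =
  trans (degree-node-apex p p′ l r (inj₁ refl))
        (cong suc (trans (cong (degree l i ℕ.+_) (degree-below r p)) (ℕP.+-identityʳ _)))

degree-node-last : ∀ {i j k} (p : i ℕ.< j) (p′ : j ℕ.< k)
  (l : Triangulation i j) (r : Triangulation j k) →
  degree (node j p p′ l r) k ≡ suc (degree r k)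
degree-node-last {k = k} p p′ l r =
  trans (degree-node-apex p p′ l r (inj₂ (inj₂ refl)))
        (cong (λ d → suc (d ℕ.+ degree r k)) (degree-above l p′))

-- solving for the apex value from the recurrence at the apex and the
-- relations at the adjacent ends of the two parts
apex-identity : ∀ (α β z u v : ℤ) {w y : ℤ} →
  y ≡ (1ℤ + α + β) * z - w → w ≡ u + α * z → y ≡ β * z + v → z ≡ u + v
apex-identity α β z u v {w} {y} at-apex left right = begin
  z                                          ≡⟨ solve 4 (λ α β z u → z := ((con 1ℤ :+ α :+ β) :* z :- (u :+ α :* z)) :- β :* z :+ u) refl α β z u ⟩
  ((1ℤ + α + β) * z - (u + α * z)) - β * z + u ≡⟨ cong (λ s → s - β * z + u) recurrence ⟩
  y - β * z + u                              ≡⟨ cong (λ s → s - β * z + u) right ⟩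
  (β * z + v) - β * z + u                    ≡⟨ solve 4 (λ β z u v → (β :* z :+ v) :- β :* z :+ u := u :+ v) refl β z u v ⟩
  u + v                                      ∎
  where
    open ≡-Reasoning
    recurrence : (1ℤ + α + β) * z - (u + α * z) ≡ y
    recurrence = trans (cong (λ s → (1ℤ + α + β) * z - s) (sym left)) (sym at-apex)

absorb-first : ∀ (α u v : ℤ) {y z : ℤ} → y ≡ α * u + z → z ≡ u + v → y ≡ (1ℤ + α) * u + v
absorb-first α u v {y} {z} first apex = begin
  y               ≡⟨ first ⟩
  α * u + z       ≡⟨ cong (λ s → α * u + s) apex ⟩
  α * u + (u + v) ≡⟨ solve 3 (λ α u v → α :* u :+ (u :+ v) := (con 1ℤ :+ α) :* u :+ v) refl α u v ⟩
  (1ℤ + α) * u + v ∎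
  where open ≡-Reasoning

absorb-last : ∀ (β u v : ℤ) {y z : ℤ} → y ≡ z + β * v → z ≡ u + v → y ≡ u + (1ℤ + β) * v
absorb-last β u v {y} {z} last apex = begin
  y               ≡⟨ last ⟩
  z + β * v       ≡⟨ cong (λ s → s + β * v) apex ⟩
  (u + v) + β * v ≡⟨ solve 3 (λ β u v → (u :+ v) :+ β :* v := u :+ (con 1ℤ :+ β) :* v) refl β u v ⟩
  u + (1ℤ + β) * v ∎
  where open ≡-Reasoning

cancel-common : ∀ (d u w : ℤ) {s : ℤ} → s ≡ d + u → s ≡ d - w → u ≡ - w
cancel-common d u w {s} plus minus = begin
  u             ≡⟨ solve 2 (λ d u → u := (d :+ u) :- d) refl d u ⟩
  (d + u) - d   ≡⟨ cong (_- d) (trans (sym plus) minus) ⟩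
  (d - w) - d   ≡⟨ solve 2 (λ d w → (d :- w) :- d := :- w) refl d w ⟩
  - w           ∎
  where open ≡-Reasoning

backwards : ∀ (p : ℤ) {y z : ℤ} → y ≡ p - z → z ≡ p - y
backwards p {y} {z} e = trans (solve 2 (λ p z → z := p :- (p :- z)) refl p z) (cong (λ s → p - s) (sym e))

x<y⇒0<y-x : ∀ {x y} → x < y → 0ℤ < y - x
x<y⇒0<y-x {x} {y} x<y = subst (_< y - x) (ℤP.+-inverseʳ x) (ℤP.+-monoˡ-< (- x) x<y)

x<y⇒x-y<0 : ∀ {x y} → x < y → x - y < 0ℤ
x<y⇒x-y<0 {x} {y} x<y = subst (x - y <_) (ℤP.+-inverseʳ y) (ℤP.+-monoˡ-< (- y) x<y)

-- if a·D = β·γ + 1 with a, β, γ > 0 then D > 0 (for positive β, γ the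
-- right-hand side normalises to a positive literal)
positive-factor : ∀ {a β γ} D → 0ℤ < a → 0ℤ < β → 0ℤ < γ → a * D ≡ β * γ + 1ℤ → 0ℤ < D
positive-factor {+ suc a} {+ suc _} {+ suc _} D (+<+ _) (+<+ _) (+<+ _) aD≡βγ+1 =
  ℤP.*-cancelˡ-<-nonNeg (+ suc a)
    (subst (_< + suc a * D) (sym (ℤP.*-zeroʳ (+ suc a))) (subst (0ℤ <_) (sym aD≡βγ+1) (+<+ (s≤s z≤n))))

SolvesInterior : ∀ {i k} → Triangulation i k → (ℕ → ℤ) → Set
SolvesInterior {i} {k} t x = ∀ w → i ≤ w → suc (suc w) ≤ k →
  x (suc (suc w)) ≡ + degree t (suc w) * x (suc w) - x w

solves-left : ∀ {i j k} (p : i ℕ.< j) (p′ : j ℕ.< k)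
  (l : Triangulation i j) (r : Triangulation j k) {x : ℕ → ℤ} →
  SolvesInterior (node j p p′ l r) x → SolvesInterior l x
solves-left p p′ l r {x} solves w i≤w w+2≤j =
  trans (solves w i≤w (ℕP.≤-trans w+2≤j (ℕP.<⇒≤ p′)))
        (cong (λ d → + d * x (suc w) - x w) (degree-node-left p p′ l r (s≤s i≤w) w+2≤j))

solves-right : ∀ {i j k} (p : i ℕ.< j) (p′ : j ℕ.< k)
  (l : Triangulation i j) (r : Triangulation j k) {x : ℕ → ℤ} →
  SolvesInterior (node j p p′ l r) x → SolvesInterior r x
solves-right p p′ l r {x} solves w j≤w w+2≤k =
  trans (solves w (ℕP.≤-trans (ℕP.<⇒≤ p) j≤w) w+2≤k)
        (cong (λ d → + d * x (suc w) - x w) (degree-node-right p p′ l r (s≤s j≤w) w+2≤k))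

EndRelations : ∀ {i k} → Triangulation i k → (ℕ → ℤ) → Set
EndRelations {i} {k} t x =
  (x (suc i) ≡ + degree t i * x i + x k) × (x (pred k) ≡ x i + + degree t k * x k)

end-relations : ∀ {i k} (t : Triangulation i k) (x : ℕ → ℤ) →
  SolvesInterior t x → EndRelations t x

apex-value : ∀ {i k} j (p : i ℕ.< j) (p′ : j ℕ.< k)
  (l : Triangulation i j) (r : Triangulation j k) (x : ℕ → ℤ) →
  SolvesInterior (node j p p′ l r) x → x j ≡ x i + x k
apex-value {i} {k} (suc j′) p@(s≤s i≤j′) p′ l r x solves =
  apex-identity (+ degree l j) (+ degree r j) (x j) (x i) (x k) at-apex
    (proj₂ (end-relations l x (solves-left p p′ l r solves)))
    (proj₁ (end-relations r x (solves-right p p′ l r solves)))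
  where
    j : ℕ
    j = suc j′
    at-apex : x (suc j) ≡ + suc (degree l j ℕ.+ degree r j) * x j - x j′
    at-apex = trans (solves j′ i≤j′ p′)
      (cong (λ d → + d * x j - x j′) (degree-node-apex p p′ l r (inj₂ (inj₁ refl))))

end-relations {i} (edge refl) x _ = sym (ℤP.+-identityˡ (x (suc i))) , sym (ℤP.+-identityʳ (x i))
end-relations {i} {k} (node j p p′ l r) x solves = first , last
  where
    apex : x j ≡ x i + x k
    apex = apex-value j p p′ l r x solves
    first : x (suc i) ≡ + degree (node j p p′ l r) i * x i + x k
    first = trans (absorb-first (+ degree l i) (x i) (x k)
                    (proj₁ (end-relations l x (solves-left p p′ l r solves))) apex)
                  (cong (λ d → + d * x i + x k) (sym (degree-node-first p p′ l r)))
    last : x (pred k) ≡ x i + + degree (node j p p′ l r) k * x k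
    last = trans (absorb-last (+ degree r k) (x i) (x k)
                   (proj₂ (end-relations r x (solves-right p p′ l r solves))) apex)
                 (cong (λ d → x i + + d * x k) (sym (degree-node-last p p′ l r)))

positive-inside : ∀ {i k} (t : Triangulation i k) (x : ℕ → ℤ) → SolvesInterior t x →
  0ℤ < x i → 0ℤ < x k → ∀ {v} → i ≤ v → v ≤ k → 0ℤ < x v
positive-inside (edge refl) x _ xi>0 xk>0 i≤v v≤k with ℕP.m≤n⇒m<n∨m≡n v≤k
... | inj₂ refl = xk>0
... | inj₁ v<k = subst (λ u → 0ℤ < x u) (ℕP.≤-antisym i≤v (s≤s⁻¹ v<k)) xi>0
positive-inside (node j p p′ l r) x solves xi>0 xk>0 {v} i≤v v≤k =
  Sum.[ (λ v≤j → positive-inside l x (solves-left p p′ l r solves) xi>0 xj>0 i≤v v≤j)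
      , (λ j≤v → positive-inside r x (solves-right p p′ l r solves) xj>0 xk>0 j≤v v≤k)
      ] (ℕP.≤-total v j)
  where
    xj>0 : 0ℤ < x j
    xj>0 = subst (0ℤ <_) (sym (apex-value j p p′ l r x solves)) (ℤP.+-mono-< xi>0 xk>0)

value-at : ∀ {n} (q : ℤ → ℤ) {q₀ : Fin n → ℕ} → (∀ i → q (+ toℕ i) ≡ + q₀ i) →
  ∀ {v} (v<n : v ℕ.< n) → q (+ v) ≡ + q₀ (fromℕ< v<n)
value-at q q-values v<n =
  trans (cong (λ u → q (+ u)) (sym (toℕ-fromℕ< v<n))) (q-values (fromℕ< v<n))

quiddity-triangulation : ∀ {n q} → IsPeriodicQuiddity n q →
  Σ ℕ λ k → n ≡ suc k × Σ (Triangulation 0 k) λ t → ∀ {v} → v ≤ k → q (+ v) ≡ + degree t v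
quiddity-triangulation {q = q} (_ , _ , inj₁ (refl , zero-entries) , q-values) =
  1 , refl , edge refl , λ v≤1 → trans (value-at q q-values (s≤s v≤1)) (cong +_ (zero-entries _))
quiddity-triangulation {suc k} {q} (_ , _ , inj₂ (_ , _ , t , degrees) , q-values) =
  k , refl , t , λ v≤k →
    trans (value-at q q-values (s≤s v≤k)) (cong +_ (trans (degrees _) (cong (degree t) (toℕ-fromℕ< _))))
quiddity-triangulation {zero} (_ , _ , inj₂ (() , _) , _)

positive-row : ∀ {k} (t : Triangulation 0 k) (q x : ℤ → ℤ) →
  (∀ {v} → v ≤ k → q (+ v) ≡ + degree t v) →
  (∀ j → x (j + 1ℤ) ≡ q j * x j - x (j - 1ℤ)) →
  x -1ℤ < 0ℤ → 0ℤ < x 0ℤ → ∀ {v} → v ≤ k → 0ℤ < x (+ v)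
positive-row {k} t q x degrees recurrence x₋₁<0 x₀>0 =
  positive-inside t y solves x₀>0 yk>0 z≤n
  where
    y : ℕ → ℤ
    y v = x (+ v)
    solves : SolvesInterior t y
    solves w _ w+2≤k =
      trans (cong (λ u → x (+ u)) (ℕP.+-comm 1 (suc w)))
            (trans (recurrence (+ suc w))
                   (cong (λ d → d * y (suc w) - y w) (degrees (ℕP.<⇒≤ w+2≤k))))
    at-zero : y 1 ≡ + degree t 0 * y 0 - x -1ℤ
    at-zero = trans (recurrence 0ℤ) (cong (λ d → d * x 0ℤ - x -1ℤ) (degrees z≤n))
    yk≡-x₋₁ : y k ≡ - x -1ℤ
    yk≡-x₋₁ = cancel-common (+ degree t 0 * y 0) (y k) (x -1ℤ)
                (proj₁ (end-relations t y solves)) at-zero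
    yk>0 : 0ℤ < y k
    yk>0 = subst (0ℤ <_) (sym yk≡-x₋₁) (ℤP.neg-mono-< x₋₁<0)

negated-solution : ∀ (q x : ℤ → ℤ) → (∀ j → x (j + 1ℤ) ≡ q j * x j - x (j - 1ℤ)) →
  ∀ j → - x (j + 1ℤ) ≡ q j * - x j - - x (j - 1ℤ)
negated-solution q x recurrence j =
  trans (cong -_ (recurrence j))
        (solve 3 (λ Q X Y → :- (Q :* X :- Y) := Q :* (:- X) :- (:- Y)) refl (q j) (x j) (x (j - 1ℤ)))

-- the corner entry A(-1,-1) = g, expressed through the initial 2×2 block
corner-identity : ∀ (a b c d Q Q′ : ℤ) {e f g : ℤ} →
  e ≡ Q * a - b → f ≡ Q * c - d → g ≡ Q′ * e - f → a * d - b * c ≡ 1ℤ →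
  a * g ≡ (b - Q * a) * (c - Q′ * a) + 1ℤ
corner-identity a b c d Q Q′ {e} {f} {g} e≡ f≡ g≡ det = begin
  a * g                                    ≡⟨ cong (a *_) (trans g≡ (cong₂ (λ s t → Q′ * s - t) e≡ f≡)) ⟩
  a * (Q′ * (Q * a - b) - (Q * c - d))     ≡⟨ solve 6 (λ a b c d Q Q′ → a :* (Q′ :* (Q :* a :- b) :- (Q :* c :- d))
                                                := (b :- Q :* a) :* (c :- Q′ :* a) :+ (a :* d :- b :* c)) refl a b c d Q Q′ ⟩
  (b - Q * a) * (c - Q′ * a) + (a * d - b * c) ≡⟨ cong (λ s → (b - Q * a) * (c - Q′ * a) + s) det ⟩
  (b - Q * a) * (c - Q′ * a) + 1ℤ          ∎
  where open ≡-Reasoning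

lemma6p1 : (n m : ℕ) → 2 ≤ n → 2 ≤ m →
    (q q′ : ℤ → ℤ) → IsPeriodicQuiddity n q → IsPeriodicQuiddity m q′ →
    (a b c d : ℤ) → 0ℤ < a → 0ℤ < b → 0ℤ < c → 0ℤ < d →
    a * d - b * c ≡ 1ℤ →
    q (+ 0) * a < b → q′ (+ 0) * a < c →
    (A : ℤ → ℤ → ℤ) →
    (∀ i j → A i (j + 1ℤ) ≡ q j * A i j - A i (j - 1ℤ)) →
    (∀ i j → A (i + 1ℤ) j ≡ q′ i * A i j - A (i - 1ℤ) j) →
    A 0ℤ 0ℤ ≡ a → A 0ℤ 1ℤ ≡ b → A 1ℤ 0ℤ ≡ c → A 1ℤ 1ℤ ≡ d →
    (i : Fin m) (j : Fin n) → 0ℤ < A (+ toℕ i) (+ toℕ j)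
lemma6p1 _ _ _ _ q q′ q-quiddity q′-quiddity a b c d a>0 _ _ _ det q₀a<b q′₀a<c
         A row-rec col-rec refl refl refl refl i j
  with quiddity-triangulation q-quiddity | quiddity-triangulation q′-quiddity
... | k , refl , t , degrees | k′ , refl , t′ , degrees′ =
  positive-row t′ q′ (λ u → A u (+ toℕ j)) degrees′ (λ u → col-rec u (+ toℕ j))
    (row₋₁<0 (s≤s⁻¹ (toℕ<n j))) (row₀>0 (s≤s⁻¹ (toℕ<n j))) (s≤s⁻¹ (toℕ<n i))
  where
    A₀₋₁ : A 0ℤ -1ℤ ≡ q 0ℤ * a - b
    A₀₋₁ = backwards (q 0ℤ * a) (row-rec 0ℤ 0ℤ)
    A₋₁₀ : A -1ℤ 0ℤ ≡ q′ 0ℤ * a - c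
    A₋₁₀ = backwards (q′ 0ℤ * a) (col-rec 0ℤ 0ℤ)
    row₀>0 : ∀ {v} → v ≤ k → 0ℤ < A 0ℤ (+ v)
    row₀>0 = positive-row t q (A 0ℤ) degrees (row-rec 0ℤ)
      (subst (_< 0ℤ) (sym A₀₋₁) (x<y⇒x-y<0 q₀a<b)) a>0
    corner>0 : 0ℤ < A -1ℤ -1ℤ
    corner>0 = positive-factor (A -1ℤ -1ℤ) a>0 (x<y⇒0<y-x q₀a<b) (x<y⇒0<y-x q′₀a<c)
      (corner-identity a b c d (q 0ℤ) (q′ 0ℤ) A₀₋₁ (backwards (q 0ℤ * c) (row-rec 1ℤ 0ℤ))
        (backwards (q′ 0ℤ * A 0ℤ -1ℤ) (col-rec 0ℤ -1ℤ)) det)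
    row₋₁<0 : ∀ {v} → v ≤ k → A -1ℤ (+ v) < 0ℤ
    row₋₁<0 {v} v≤k = ℤP.neg-cancel-< {0ℤ} {A -1ℤ (+ v)}
      (positive-row t q (λ u → - A -1ℤ u) degrees (negated-solution q (A -1ℤ) (row-rec -1ℤ))
        (ℤP.neg-mono-< corner>0)
        (ℤP.neg-mono-< (subst (_< 0ℤ) (sym A₋₁₀) (x<y⇒x-y<0 q′₀a<c))) v≤k)
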